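{- For every integer $n\geq 3$, $$\alpha_n^3=n^3-7n^2+15n-10+\frac{1+(-1)^{n-1}}{2}.$$
   Context: $\mathbb{Z}_n$ is the ring of integers modulo $n$. A vector $(v_1,v_2,v_3)\in\mathbb{Z}_n^3$ is zero-sum-free if there is no non-empty subset of its components whose sum is $0$ in $\mathbb{Z}_n$; $\alpha_n^3$ denotes the number of zero-sum-free vectors in $\mathbb{Z}_n^3$. -}

module Defs where

open import Data.Nat using (ℕ; zero; suc; _+_; _*_; _%_; NonZero)
open import Data.Nat.Properties using () renaming (_≟_ to _≟ℕ_)
open import Data.Fin using (Fin; toℕ)
open import Data.Fin.Subset using (Subset; Nonempty; inside; outside)
open import Data.Fin.Subset.Properties using (nonempty?; anySubset?)
open import Data.Bool using (Bool; true; false)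
open import Data.Product using (_×_; _,_; ∃)
open import Data.List using (List; length; filter; allFin; cartesianProductWith; concatMap; map)
open import Data.Vec using (Vec; _∷_; [])
open import Relation.Nullary using (¬_; Dec; yes; no)
open import Relation.Nullary.Decidable using (¬?; _×-dec_)
open import Relation.Binary.PropositionalEquality using (_≡_)

-- A vector in ℤ_n^k, components represented by residues Fin n (= 0..n-1).
-- Sum (as a natural number) of the components of v selected by the subset s.
subsetSum : ∀ {n k} → Vec (Fin n) k → Subset k → ℕ
subsetSum [] [] = 0
subsetSum (x ∷ v) (inside ∷ s) = toℕ x + subsetSum v s
subsetSum (x ∷ v) (outside ∷ s) = subsetSum v s

ZeroSumFree : ∀ (n : ℕ) .{{_ : NonZero n}} {k} → Vec (Fin n) k → Set
ZeroSumFree n {k} v = (s : Subset k) → Nonempty s → ¬ (subsetSum v s % n ≡ 0)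

zeroSumFree? : ∀ (n : ℕ) .{{_ : NonZero n}} {k} (v : Vec (Fin n) k) → Dec (ZeroSumFree n v)
zeroSumFree? n v with anySubset? (λ s → nonempty? s ×-dec ((subsetSum v s % n) ≟ℕ 0))
... | yes (s , ne , z) = no (λ f → f s ne z)
... | no ¬e = yes (λ s ne z → ¬e (s , ne , z))

allVec3 : (n : ℕ) → List (Vec (Fin n) 3)
allVec3 n = concatMap (λ a → concatMap (λ b → map (λ c → a ∷ b ∷ c ∷ []) (allFin n)) (allFin n)) (allFin n)

α3 : (n : ℕ) .{{_ : NonZero n}} → ℕ
α3 n = length (filter (zeroSumFree? n) (allVec3 n))

-- Represent residues by 0 ≤ a, b, c < n. All subset sums of (a, b, c) are below 3n, so the triple
-- is zero-sum-free iff none of its seven subset sums is 0, n or 2n. For fixed a, b with a, b ≠ 0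
-- and a + b ≠ n, a third entry c must avoid 0, n − a, n − b and the one value putting a + b + c
-- in {n, 2n}; these are distinct unless a = b, leaving n − 4 + [a = b] choices. Summing over the
-- n − 2 admissible b gives (n − 2)(n − 4) + 1 − [2a = n] = (n − 3)² − [2a = n], and summing over
-- the n − 1 nonzero a gives α = (n − 1)(n − 3)² − [n even], which is the stated polynomial.
module Submission where

open import Defs

module Counting where

  open import Data.Bool.Base using (true; false; if_then_else_)
  open import Data.Empty using (⊥-elim)
  open import Data.Fin.Base using (Fin; zero; suc; toℕ)
  open import Data.Fin.Properties using (toℕ≤pred[n])
  open import Data.Fin.Subset using (Subset; Nonempty; inside; outside)
  open import Data.Fin.Subset.Properties using (∉⊥)
  open import Data.List.Base using (List; []; _∷_; _++_; length; filter; map; concatMap; tabulate; allFin)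
  open import Data.List.Properties using (map-++; map-∘; map-cong; map-tabulate)
  open import Data.Nat.Base
  open import Data.Nat.DivMod using (n%n≡0; m*n%n≡0; [m+n]%n≡m%n)
  open import Data.Nat.Divisibility using (divides; m%n≡0⇒n∣m)
  open import Data.Nat.ListAction using () renaming (sum to sumᴸ)
  open import Data.Nat.ListAction.Properties using () renaming (sum-++ to sumᴸ-++)
  open import Data.Nat.Properties
  open import Data.Nat.Tactic.RingSolver using (solve-∀)
  open import Data.Product.Base using (_×_; _,_; proj₁; ∃-syntax)
  open import Data.Sum.Base using (_⊎_; inj₁; inj₂; [_,_])
  open import Data.Vec.Base using (Vec; []; _∷_; here; there)
  open import Function.Base using (_∘_)
  open import Function.Bundles using (_⇔_; mk⇔; Equivalence)
  open import Function.Properties.Equivalence using () renaming (trans to ⇔-trans)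
  open import Relation.Binary.Definitions using (tri<; tri≈; tri>)
  open import Relation.Binary.PropositionalEquality
    using (_≡_; _≢_; refl; sym; trans; cong; cong₂; subst; module ≡-Reasoning)
  open import Relation.Nullary.Decidable using (Dec; yes; no; does; does-⇔; dec-true; dec-false; ¬?; _×-dec_)
  open import Relation.Nullary.Negation using (¬_; contradiction)
  open import Relation.Unary using (Decidable)

  open import Algebra.Properties.CommutativeSemigroup +-commutativeSemigroup using (interchange; xy∙z≈xz∙y)

  𝟙 : ∀ {P : Set} → Dec P → ℕ
  𝟙 P? = if does P? then 1 else 0

  module _ {P : Set} (P? : Dec P) where

    𝟙-yes : P → 𝟙 P? ≡ 1
    𝟙-yes p rewrite dec-true P? p = refl

    𝟙-no : ¬ P → 𝟙 P? ≡ 0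
    𝟙-no ¬p rewrite dec-false P? ¬p = refl

    𝟙-¬ : 𝟙 (¬? P?) + 𝟙 P? ≡ 1
    𝟙-¬ with does P?
    ... | true  = refl
    ... | false = refl

  𝟙-cong : ∀ {P Q : Set} → P ⇔ Q → (P? : Dec P) (Q? : Dec Q) → 𝟙 P? ≡ 𝟙 Q?
  𝟙-cong P⇔Q P? Q? = cong (λ b → if b then 1 else 0) (does-⇔ P⇔Q P? Q?)

  δ : ℕ → ℕ → ℕ
  δ x y = 𝟙 (x ≟ y)

  δ≡1 : ∀ {x y} → x ≡ y → δ x y ≡ 1
  δ≡1 {x} {y} = 𝟙-yes (x ≟ y)

  δ≡0 : ∀ {x y} → x ≢ y → δ x y ≡ 0
  δ≡0 {x} {y} = 𝟙-no (x ≟ y)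

  δ-shift : ∀ k x y → δ (k + x) (k + y) ≡ δ x y
  δ-shift k x y = 𝟙-cong (mk⇔ (+-cancelˡ-≡ k x y) (cong (k +_))) (k + x ≟ k + y) (x ≟ y)

  -- Defined by recursion rather than through the library's Fin-indexed sum, so that Agda can
  -- infer the summand from an equation between two sums ∑ n f ≡ ∑ n g with n a variable.
  ∑ : ℕ → (ℕ → ℕ) → ℕ
  ∑ zero    f = 0
  ∑ (suc n) f = f 0 + ∑ n (f ∘ suc)

  syntax ∑ n (λ i → e) = ∑[ i < n ] e

  ∑-cong : ∀ n {f g : ℕ → ℕ} → (∀ i → i < n → f i ≡ g i) → ∑ n f ≡ ∑ n g
  ∑-cong zero    f≡g = refl
  ∑-cong (suc n) f≡g = cong₂ _+_ (f≡g 0 z<s) (∑-cong n (λ i i<n → f≡g (suc i) (s<s i<n)))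

  ∑-distrib-+ : ∀ n (f g : ℕ → ℕ) → ∑[ i < n ] (f i + g i) ≡ ∑ n f + ∑ n g
  ∑-distrib-+ zero    f g = refl
  ∑-distrib-+ (suc n) f g =
    trans (cong (f 0 + g 0 +_) (∑-distrib-+ n (f ∘ suc) (g ∘ suc))) (interchange (f 0) (g 0) _ _)

  ∑-+ : ∀ n {f g : ℕ → ℕ} {x y} → ∑ n f ≡ x → ∑ n g ≡ y → ∑[ i < n ] (f i + g i) ≡ x + y
  ∑-+ n {f} {g} ∑f≡x ∑g≡y = trans (∑-distrib-+ n f g) (cong₂ _+_ ∑f≡x ∑g≡y)

  ∑-const : ∀ n x → ∑[ i < n ] x ≡ n * x
  ∑-const zero    x = refl
  ∑-const (suc n) x = cong (x +_) (∑-const n x)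

  ∑-*ˡ : ∀ n x (f : ℕ → ℕ) → ∑[ i < n ] (x * f i) ≡ x * ∑ n f
  ∑-*ˡ zero    x f = sym (*-zeroʳ x)
  ∑-*ˡ (suc n) x f = trans (cong (x * f 0 +_) (∑-*ˡ n x (f ∘ suc))) (sym (*-distribˡ-+ x (f 0) _))

  ∑-zero : ∀ n {f : ℕ → ℕ} → (∀ i → i < n → f i ≡ 0) → ∑ n f ≡ 0
  ∑-zero n f≡0 = trans (∑-cong n f≡0) (trans (∑-const n 0) (*-zeroʳ n))

  ∑-δ : ∀ n m → ∑[ i < n ] δ i m ≡ 𝟙 (m <? n)
  ∑-δ zero    m       = refl
  ∑-δ (suc n) zero    = cong suc (∑-zero n (λ _ _ → refl))
  ∑-δ (suc n) (suc m) = ∑-δ n m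

  ∑-δ-shift : ∀ n k m → ∑[ i < n ] δ (k + i) m ≡ 𝟙 (k ≤? m ×-dec m <? k + n)
  ∑-δ-shift n k m with k ≤? m
  ... | no k≰m = begin
    ∑[ i < n ] δ (k + i) m       ≡⟨ ∑-zero n (λ i _ → δ≡0 (k≰m ∘ k+i≡m⇒k≤m i)) ⟩
    0                            ≡⟨ 𝟙-no (k ≤? m ×-dec m <? k + n) (k≰m ∘ proj₁) ⟨
    𝟙 (k ≤? m ×-dec m <? k + n)  ∎
    where
    open ≡-Reasoning
    k+i≡m⇒k≤m : ∀ i → k + i ≡ m → k ≤ m
    k+i≡m⇒k≤m i k+i≡m = subst (k ≤_) k+i≡m (m≤m+n k i)
  ... | yes k≤m with (j , refl) ← m≤n⇒∃[o]m+o≡n k≤m = begin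
    ∑[ i < n ] δ (k + i) (k + j)         ≡⟨ ∑-cong n (λ i _ → δ-shift k i j) ⟩
    ∑[ i < n ] δ i j                     ≡⟨ ∑-δ n j ⟩
    𝟙 (j <? n)                           ≡⟨ 𝟙-cong j<n⇔ (j <? n) (k ≤? k + j ×-dec k + j <? k + n) ⟩
    𝟙 (k ≤? k + j ×-dec k + j <? k + n)  ∎
    where
    open ≡-Reasoning
    j<n⇔ : j < n ⇔ (k ≤ k + j × k + j < k + n)
    j<n⇔ = mk⇔ (λ j<n → k≤m , +-monoʳ-< k j<n) (λ (_ , k+j<k+n) → +-cancelˡ-< k j n k+j<k+n)

  ∑-δ-0 : ∀ {n} → 0 < n → ∑[ i < n ] δ i 0 ≡ 1
  ∑-δ-0 {n} 0<n = trans (∑-δ n 0) (𝟙-yes (0 <? n) 0<n)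

  ∑-δ-complement : ∀ {n k} → k ≢ 0 → k < n → ∑[ i < n ] δ (k + i) n ≡ 1
  ∑-δ-complement {n} {k} k≢0 k<n =
    trans (∑-δ-shift n k n) (𝟙-yes (k ≤? n ×-dec n <? k + n) (<⇒≤ k<n , m<n+m n (n≢0⇒n>0 k≢0)))

  ∑-δ-sift : ∀ {n} (f : ℕ → ℕ) m → m < n → ∑[ i < n ] (f i * δ i m) ≡ f m
  ∑-δ-sift {suc n} f zero    _         =
    trans (cong₂ _+_ (*-identityʳ (f 0)) (∑-zero n (λ i _ → *-zeroʳ (f (suc i))))) (+-identityʳ (f 0))
  ∑-δ-sift {suc n} f (suc m) (s≤s m<n) =
    trans (cong (_+ ∑[ i < n ] (f (suc i) * δ i m)) (*-zeroʳ (f 0))) (∑-δ-sift (f ∘ suc) m m<n)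

  NotMultiple : ℕ → ℕ → Set
  NotMultiple n x = x ≢ 0 × x ≢ n × x ≢ n + n

  notMultiple? : ∀ n x → Dec (NotMultiple n x)
  notMultiple? n x = ¬? (x ≟ 0) ×-dec ¬? (x ≟ n) ×-dec ¬? (x ≟ n + n)

  Sums₃ : (ℕ → Set) → ℕ → ℕ → ℕ → Set
  Sums₃ Q a b c = Q a × Q b × Q c × Q (a + b) × Q (a + c) × Q (b + c) × Q (a + b + c)

  ZeroSumFreeTriple : ℕ → ℕ → ℕ → ℕ → Set
  ZeroSumFreeTriple n = Sums₃ (NotMultiple n)

  zeroSumFreeTriple? : ∀ n a b c → Dec (ZeroSumFreeTriple n a b c)
  zeroSumFreeTriple? n a b c =
    m? a ×-dec m? b ×-dec m? c ×-dec m? (a + b) ×-dec m? (a + c) ×-dec m? (b + c) ×-dec m? (a + b + c)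
    where
    m? : ∀ x → Dec (NotMultiple n x)
    m? = notMultiple? n

  module _ {n : ℕ} .{{_ : NonZero n}} where

    %≡0⇔small-multiple : ∀ {x} → x < 3 * n → x % n ≡ 0 ⇔ (x ≡ 0 ⊎ x ≡ n ⊎ x ≡ n + n)
    %≡0⇔small-multiple {x} x<3n =
      mk⇔ to [ (λ { refl → m*n%n≡0 0 n }) , [ (λ { refl → n%n≡0 n }) , (λ { refl → [n+n]%n≡0 }) ] ]
      where
      [n+n]%n≡0 : (n + n) % n ≡ 0
      [n+n]%n≡0 = trans ([m+n]%n≡m%n n n) (n%n≡0 n)
      to : x % n ≡ 0 → x ≡ 0 ⊎ x ≡ n ⊎ x ≡ n + n
      to x%n≡0 with m%n≡0⇒n∣m x n x%n≡0
      ... | divides 0 x≡0                    = inj₁ x≡0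
      ... | divides 1 x≡n                    = inj₂ (inj₁ (trans x≡n (+-identityʳ n)))
      ... | divides 2 x≡2n                   = inj₂ (inj₂ (trans x≡2n (cong (n +_) (+-identityʳ n))))
      ... | divides (suc (suc (suc q))) refl = contradiction (*-monoˡ-≤ n (m≤m+n 3 q)) (<⇒≱ x<3n)

    ¬%≡0⇔NotMultiple : ∀ {x} → x < 3 * n → (¬ x % n ≡ 0) ⇔ NotMultiple n x
    ¬%≡0⇔NotMultiple x<3n = mk⇔
      (λ ¬x%n≡0 → (¬x%n≡0 ∘ from ∘ inj₁) , (¬x%n≡0 ∘ from ∘ inj₂ ∘ inj₁)
                , (¬x%n≡0 ∘ from ∘ inj₂ ∘ inj₂))
      (λ (x≢0 , x≢n , x≢2n) → [ x≢0 , [ x≢n , x≢2n ] ] ∘ to)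
      where open Equivalence (%≡0⇔small-multiple x<3n)

    subsetSum≤ : ∀ {k} (v : Vec (Fin n) k) s → subsetSum v s ≤ k * pred n
    subsetSum≤ []      []            = z≤n
    subsetSum≤ (x ∷ v) (inside ∷ s)  = +-mono-≤ (toℕ≤pred[n] x) (subsetSum≤ v s)
    subsetSum≤ (x ∷ v) (outside ∷ s) = ≤-trans (subsetSum≤ v s) (m≤n+m _ (pred n))

    subsetSum<3n : ∀ {k} → k ≤ 3 → (v : Vec (Fin n) k) (s : Subset k) → subsetSum v s < 3 * n
    subsetSum<3n k≤3 v s = ≤-<-trans (≤-trans (subsetSum≤ v s) (*-monoˡ-≤ (pred n) k≤3))
                                     (*-monoʳ-< 3 (m≤pred[n]⇒suc[m]≤n ≤-refl))

    zeroSumFree⇔ : ∀ {k} → k ≤ 3 → (v : Vec (Fin n) k) →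
                   ZeroSumFree n v ⇔ (∀ s → Nonempty s → NotMultiple n (subsetSum v s))
    zeroSumFree⇔ k≤3 v = mk⇔ (λ zsf s ne → to (equiv s) (zsf s ne)) (λ nm s ne → from (equiv s) (nm s ne))
      where
      open Equivalence
      equiv : ∀ s → (¬ subsetSum v s % n ≡ 0) ⇔ NotMultiple n (subsetSum v s)
      equiv s = ¬%≡0⇔NotMultiple (subsetSum<3n k≤3 v s)

  nonemptySubsets₃ : ∀ {n} (Q : ℕ → Set) (a b c : Fin n) →
    (∀ s → Nonempty s → Q (subsetSum (a ∷ b ∷ c ∷ []) s)) ⇔ Sums₃ Q (toℕ a) (toℕ b) (toℕ c)
  nonemptySubsets₃ Q a b c = mk⇔ to from
    where
    x y z : ℕ
    x = toℕ a
    y = toℕ b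
    z = toℕ c
    x+[y+[z+0]] : x + (y + (z + 0)) ≡ x + y + z
    x+[y+[z+0]] = trans (cong (λ t → x + (y + t)) (+-identityʳ z)) (sym (+-assoc x y z))
    to : (∀ s → Nonempty s → Q (subsetSum (a ∷ b ∷ c ∷ []) s)) → Sums₃ Q x y z
    to h = subst Q (+-identityʳ x) (h (inside ∷ outside ∷ outside ∷ []) (zero , here))
         , subst Q (+-identityʳ y) (h (outside ∷ inside ∷ outside ∷ []) (suc zero , there here))
         , subst Q (+-identityʳ z) (h (outside ∷ outside ∷ inside ∷ []) (suc (suc zero) , there (there here)))
         , subst Q (cong (x +_) (+-identityʳ y)) (h (inside ∷ inside ∷ outside ∷ []) (zero , here))
         , subst Q (cong (x +_) (+-identityʳ z)) (h (inside ∷ outside ∷ inside ∷ []) (zero , here))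
         , subst Q (cong (y +_) (+-identityʳ z)) (h (outside ∷ inside ∷ inside ∷ []) (suc zero , there here))
         , subst Q x+[y+[z+0]] (h (inside ∷ inside ∷ inside ∷ []) (zero , here))
    from : Sums₃ Q x y z → ∀ s → Nonempty s → Q (subsetSum (a ∷ b ∷ c ∷ []) s)
    from _                              (outside ∷ outside ∷ outside ∷ []) (_ , i∈∅) = ⊥-elim (∉⊥ i∈∅)
    from (qx , _)                       (inside ∷ outside ∷ outside ∷ []) _ = subst Q (sym (+-identityʳ x)) qx
    from (_ , qy , _)                   (outside ∷ inside ∷ outside ∷ []) _ = subst Q (sym (+-identityʳ y)) qy
    from (_ , _ , qz , _)               (outside ∷ outside ∷ inside ∷ []) _ = subst Q (sym (+-identityʳ z)) qz
    from (_ , _ , _ , qxy , _)          (inside ∷ inside ∷ outside ∷ [])  _ =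
      subst Q (sym (cong (x +_) (+-identityʳ y))) qxy
    from (_ , _ , _ , _ , qxz , _)      (inside ∷ outside ∷ inside ∷ [])  _ =
      subst Q (sym (cong (x +_) (+-identityʳ z))) qxz
    from (_ , _ , _ , _ , _ , qyz , _)  (outside ∷ inside ∷ inside ∷ [])  _ =
      subst Q (sym (cong (y +_) (+-identityʳ z))) qyz
    from (_ , _ , _ , _ , _ , _ , qxyz) (inside ∷ inside ∷ inside ∷ [])   _ = subst Q (sym x+[y+[z+0]]) qxyz

  zeroSumFree₃⇔ : ∀ {n} .{{_ : NonZero n}} (a b c : Fin n) →
                  ZeroSumFree n (a ∷ b ∷ c ∷ []) ⇔ ZeroSumFreeTriple n (toℕ a) (toℕ b) (toℕ c)
  zeroSumFree₃⇔ {n} a b c =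
    ⇔-trans (zeroSumFree⇔ ≤-refl (a ∷ b ∷ c ∷ [])) (nonemptySubsets₃ (NotMultiple n) a b c)

  length-filter≡sum𝟙 : ∀ {A : Set} {P : A → Set} (P? : Decidable P) xs →
                       length (filter P? xs) ≡ sumᴸ (map (𝟙 ∘ P?) xs)
  length-filter≡sum𝟙 P? []       = refl
  length-filter≡sum𝟙 P? (x ∷ xs) with does (P? x)
  ... | true  = cong suc (length-filter≡sum𝟙 P? xs)
  ... | false = length-filter≡sum𝟙 P? xs

  sum-map-concatMap : ∀ {A B : Set} (w : B → ℕ) (f : A → List B) xs →
                      sumᴸ (map w (concatMap f xs)) ≡ sumᴸ (map (λ x → sumᴸ (map w (f x))) xs)
  sum-map-concatMap w f []       = refl
  sum-map-concatMap w f (x ∷ xs) = begin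
    sumᴸ (map w (f x ++ concatMap f xs))                ≡⟨ cong sumᴸ (map-++ w (f x) (concatMap f xs)) ⟩
    sumᴸ (map w (f x) ++ map w (concatMap f xs))        ≡⟨ sumᴸ-++ (map w (f x)) (map w (concatMap f xs)) ⟩
    sumᴸ (map w (f x)) + sumᴸ (map w (concatMap f xs))  ≡⟨ cong (_ +_) (sum-map-concatMap w f xs) ⟩
    sumᴸ (map w (f x)) + sumᴸ (map (λ x → sumᴸ (map w (f x))) xs) ∎
    where open ≡-Reasoning

  sum-tabulate : ∀ n (g : ℕ → ℕ) → sumᴸ (tabulate {n = n} (g ∘ toℕ)) ≡ ∑ n g
  sum-tabulate zero    g = refl
  sum-tabulate (suc n) g = cong (g 0 +_) (sum-tabulate n (g ∘ suc))

  sum-map-allFin : ∀ n {w : Fin n → ℕ} (g : ℕ → ℕ) → (∀ i → w i ≡ g (toℕ i)) →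
                   sumᴸ (map w (allFin n)) ≡ ∑ n g
  sum-map-allFin n {w} g w≡g = begin
    sumᴸ (map w (allFin n))            ≡⟨ cong sumᴸ (map-cong w≡g (allFin n)) ⟩
    sumᴸ (map (g ∘ toℕ) (allFin n))    ≡⟨ cong sumᴸ (map-tabulate {n = n} (λ i → i) (g ∘ toℕ)) ⟩
    sumᴸ (tabulate {n = n} (g ∘ toℕ))  ≡⟨ sum-tabulate n g ⟩
    ∑ n g                              ∎
    where open ≡-Reasoning

  α3≡∑ : ∀ n .{{_ : NonZero n}} → α3 n ≡ ∑[ a < n ] ∑[ b < n ] ∑[ c < n ] 𝟙 (zeroSumFreeTriple? n a b c)
  α3≡∑ n = begin
    length (filter (zeroSumFree? n) (allVec3 n))            ≡⟨ length-filter≡sum𝟙 (zeroSumFree? n) (allVec3 n) ⟩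
    sumᴸ (map w (allVec3 n))                                ≡⟨ sum-map-concatMap w triples (allFin n) ⟩
    sumᴸ (map (λ a → sumᴸ (map w (triples a))) (allFin n))  ≡⟨ sum-map-allFin n _ count-bc ⟩
    ∑[ a < n ] ∑[ b < n ] ∑[ c < n ] 𝟙 (zeroSumFreeTriple? n a b c) ∎
    where
    open ≡-Reasoning
    w : Vec (Fin n) 3 → ℕ
    w = 𝟙 ∘ zeroSumFree? n
    triples : Fin n → List (Vec (Fin n) 3)
    triples a = concatMap (λ b → map (λ c → a ∷ b ∷ c ∷ []) (allFin n)) (allFin n)
    count-c : ∀ a b → sumᴸ (map w (map (λ c → a ∷ b ∷ c ∷ []) (allFin n)))
                      ≡ ∑[ c < n ] 𝟙 (zeroSumFreeTriple? n (toℕ a) (toℕ b) c)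
    count-c a b = trans (cong sumᴸ (sym (map-∘ (allFin n))))
      (sum-map-allFin n _ (λ c → 𝟙-cong (zeroSumFree₃⇔ a b c) (zeroSumFree? n (a ∷ b ∷ c ∷ []))
                                        (zeroSumFreeTriple? n (toℕ a) (toℕ b) (toℕ c))))
    count-bc : ∀ a → sumᴸ (map w (triples a)) ≡ ∑[ b < n ] ∑[ c < n ] 𝟙 (zeroSumFreeTriple? n (toℕ a) b c)
    count-bc a = trans (sum-map-concatMap w _ (allFin n)) (sum-map-allFin n _ (count-c a))

  module _ {n a b : ℕ} (a≢0 : a ≢ 0) (a<n : a < n) (b≢0 : b ≢ 0) (b<n : b < n) (a+b≢n : a + b ≢ n) where

    private
      n≢0 : n ≢ 0
      n≢0 = >⇒≢ (≤-<-trans z≤n a<n)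

      n≢n+x : ∀ {x} → x ≢ 0 → n ≢ n + x
      n≢n+x x≢0 n≡n+x = x≢0 (sym (+-cancelˡ-≡ n 0 _ (trans (+-identityʳ n) n≡n+x)))

    completes : ∀ {c} → c < n → c ≢ 0 → a + c ≢ n → b + c ≢ n → a + b + c ≢ n → a + b + c ≢ n + n →
                ZeroSumFreeTriple n a b c
    completes c<n c≢0 a+c≢n b+c≢n a+b+c≢n a+b+c≢2n =
        below2n a≢0 (<⇒≢ a<n) (<-≤-trans a<n (m≤m+n n n))
      , below2n b≢0 (<⇒≢ b<n) (<-≤-trans b<n (m≤m+n n n))
      , below2n c≢0 (<⇒≢ c<n) (<-≤-trans c<n (m≤m+n n n))
      , below2n (a≢0 ∘ m+n≡0⇒m≡0 a) a+b≢n (+-mono-< a<n b<n)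
      , below2n (a≢0 ∘ m+n≡0⇒m≡0 a) a+c≢n (+-mono-< a<n c<n)
      , below2n (b≢0 ∘ m+n≡0⇒m≡0 b) b+c≢n (+-mono-< b<n c<n)
      , (a≢0 ∘ m+n≡0⇒m≡0 a ∘ m+n≡0⇒m≡0 (a + b)) , a+b+c≢n , a+b+c≢2n
      where
      below2n : ∀ {x} → x ≢ 0 → x ≢ n → x < n + n → NotMultiple n x
      below2n x≢0 x≢n x<2n = x≢0 , x≢n , <⇒≢ x<2n

    -- c fails to complete (a, b) exactly when c = 0, a + c = n, b + c = n or a + b + c ∈ {n, 2n};
    -- these events are pairwise exclusive except that a + c = n and b + c = n coincide when a = b.
    completes+obstructions : ∀ c → c < n →
      𝟙 (zeroSumFreeTriple? n a b c)
        + (δ c 0 + δ (a + c) n + δ (b + c) n + (δ (a + b + c) n + δ (a + b + c) (n + n)))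
      ≡ 1 + δ b a * δ (a + c) n
    completes+obstructions c c<n with c ≟ 0
    ... | yes refl
        rewrite +-identityʳ a | +-identityʳ b | +-identityʳ (a + b)
              | 𝟙-no (zeroSumFreeTriple? n a b 0) (λ (_ , _ , (c≢0 , _) , _) → c≢0 refl)
              | δ≡0 (<⇒≢ a<n) | δ≡0 (<⇒≢ b<n) | δ≡0 a+b≢n | δ≡0 (<⇒≢ (+-mono-< a<n b<n))
        = cong suc (sym (*-zeroʳ (δ b a)))
    ... | no c≢0 with a + c ≟ n
    ... | yes a+c≡n
        rewrite 𝟙-no (zeroSumFreeTriple? n a b c) (λ (_ , _ , _ , _ , (_ , a+c≢n , _) , _) → a+c≢n a+c≡n)
              | δ≡0 c≢0 | δ≡1 a+c≡n | xy∙z≈xz∙y a b c | a+c≡n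
              | δ≡0 (n≢n+x b≢0 ∘ sym) | δ≡0 (<⇒≢ (+-monoʳ-< n b<n))
              | 𝟙-cong (mk⇔ (λ b+c≡n → +-cancelʳ-≡ c b a (trans b+c≡n (sym a+c≡n)))
                             (λ { refl → a+c≡n }))
                        (b + c ≟ n) (b ≟ a)
        = cong suc (trans (+-identityʳ (δ b a)) (sym (*-identityʳ (δ b a))))
    ... | no a+c≢n with b + c ≟ n
    ... | yes b+c≡n
        rewrite 𝟙-no (zeroSumFreeTriple? n a b c) (λ (_ , _ , _ , _ , _ , (_ , b+c≢n , _) , _) → b+c≢n b+c≡n)
              | δ≡0 c≢0 | δ≡0 a+c≢n | δ≡1 b+c≡n | +-assoc a b c | b+c≡n
              | δ≡0 (λ a+n≡n → n≢n+x a≢0 (trans (sym a+n≡n) (+-comm a n)))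
              | δ≡0 (<⇒≢ (+-monoˡ-< n a<n))
        = cong suc (sym (*-zeroʳ (δ b a)))
    ... | no b+c≢n with a + b + c ≟ n
    ... | yes a+b+c≡n
        rewrite 𝟙-no (zeroSumFreeTriple? n a b c)
                     (λ (_ , _ , _ , _ , _ , _ , (_ , a+b+c≢n , _)) → a+b+c≢n a+b+c≡n)
              | δ≡0 c≢0 | δ≡0 a+c≢n | δ≡0 b+c≢n | δ≡1 a+b+c≡n
              | δ≡0 (n≢n+x n≢0 ∘ trans (sym a+b+c≡n))
        = cong suc (sym (*-zeroʳ (δ b a)))
    ... | no a+b+c≢n with a + b + c ≟ n + n
    ... | yes a+b+c≡2n
        rewrite 𝟙-no (zeroSumFreeTriple? n a b c)
                     (λ (_ , _ , _ , _ , _ , _ , (_ , _ , a+b+c≢2n)) → a+b+c≢2n a+b+c≡2n)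
              | δ≡0 c≢0 | δ≡0 a+c≢n | δ≡0 b+c≢n | δ≡0 a+b+c≢n | δ≡1 a+b+c≡2n
        = cong suc (sym (*-zeroʳ (δ b a)))
    ... | no a+b+c≢2n
        rewrite 𝟙-yes (zeroSumFreeTriple? n a b c) (completes c<n c≢0 a+c≢n b+c≢n a+b+c≢n a+b+c≢2n)
              | δ≡0 c≢0 | δ≡0 a+c≢n | δ≡0 b+c≢n | δ≡0 a+b+c≢n | δ≡0 a+b+c≢2n
        = cong suc (sym (*-zeroʳ (δ b a)))

    ∑-completions : ∑[ c < n ] 𝟙 (zeroSumFreeTriple? n a b c) + 4 ≡ n + δ b a
    ∑-completions = begin
      ∑[ c < n ] 𝟙 (zeroSumFreeTriple? n a b c) + 4
        ≡⟨ ∑-+ n refl ∑-obstructions ⟨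
      ∑[ c < n ] (𝟙 (zeroSumFreeTriple? n a b c)
                   + (δ c 0 + δ (a + c) n + δ (b + c) n + (δ (a + b + c) n + δ (a + b + c) (n + n))))
        ≡⟨ ∑-cong n completes+obstructions ⟩
      ∑[ c < n ] (1 + δ b a * δ (a + c) n)
        ≡⟨ ∑-+ n (∑-const n 1) (trans (∑-*ˡ n (δ b a) (λ c → δ (a + c) n))
                                        (cong (δ b a *_) (∑-δ-complement a≢0 a<n))) ⟩
      n * 1 + δ b a * 1
        ≡⟨ cong₂ _+_ (*-identityʳ n) (*-identityʳ (δ b a)) ⟩
      n + δ b a ∎
      where
      open ≡-Reasoning
      a+b+c≡n∨2n : ∑[ c < n ] (δ (a + b + c) n + δ (a + b + c) (n + n)) ≡ 1
      a+b+c≡n∨2n with <-cmp (a + b) n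
      ... | tri< a+b<n _ _ = ∑-+ n
        (trans (∑-δ-shift n (a + b) n) (𝟙-yes (a + b ≤? n ×-dec n <? a + b + n)
                                              (<⇒≤ a+b<n , m<n+m n (n≢0⇒n>0 (a≢0 ∘ m+n≡0⇒m≡0 a)))))
        (trans (∑-δ-shift n (a + b) (n + n)) (𝟙-no (a + b ≤? n + n ×-dec n + n <? a + b + n)
                                              (λ (_ , 2n<a+b+n) → <⇒≱ 2n<a+b+n (+-monoˡ-≤ n (<⇒≤ a+b<n)))))
      ... | tri≈ _ a+b≡n _ = contradiction a+b≡n a+b≢n
      ... | tri> _ _ a+b>n = ∑-+ n
        (trans (∑-δ-shift n (a + b) n) (𝟙-no (a + b ≤? n ×-dec n <? a + b + n)
                                              (λ (a+b≤n , _) → <⇒≱ a+b>n a+b≤n)))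
        (trans (∑-δ-shift n (a + b) (n + n)) (𝟙-yes (a + b ≤? n + n ×-dec n + n <? a + b + n)
                                              (<⇒≤ (+-mono-< a<n b<n) , +-monoˡ-< n a+b>n)))
      ∑-obstructions : ∑[ c < n ] (δ c 0 + δ (a + c) n + δ (b + c) n + (δ (a + b + c) n + δ (a + b + c) (n + n))) ≡ 4
      ∑-obstructions = ∑-+ n (∑-+ n (∑-+ n (∑-δ-0 (≤-<-trans z≤n a<n)) (∑-δ-complement a≢0 a<n))
                                    (∑-δ-complement b≢0 b<n))
                             a+b+c≡n∨2n

  module _ {n a : ℕ} (a≢0 : a ≢ 0) (a<n : a < n) where

    admissible? : ∀ b → Dec (b ≢ 0 × a + b ≢ n)
    admissible? b = ¬? (b ≟ 0) ×-dec ¬? (a + b ≟ n)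

    ∑-completions-inadmissible : ∀ {b} → ¬ (b ≢ 0 × a + b ≢ n) →
                                 ∑[ c < n ] 𝟙 (zeroSumFreeTriple? n a b c) ≡ 0
    ∑-completions-inadmissible {b} ¬admissible = ∑-zero n (λ c _ →
      𝟙-no (zeroSumFreeTriple? n a b c)
           (λ (_ , (b≢0 , _) , _ , (_ , a+b≢n , _) , _) → ¬admissible (b≢0 , a+b≢n)))

    -- Weighting by admissibility makes ∑-completions an identity for every b < n, so it can be summed.
    ∑-completions-weighted : ∀ b → b < n →
      ∑[ c < n ] 𝟙 (zeroSumFreeTriple? n a b c) + 4 * 𝟙 (admissible? b)
        ≡ n * 𝟙 (admissible? b) + 𝟙 (admissible? b) * δ b a
    ∑-completions-weighted b b<n with b ≟ 0 | a + b ≟ n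
    ... | no b≢0  | no a+b≢n  rewrite 𝟙-yes (admissible? b) (b≢0 , a+b≢n) =
      trans (∑-completions a≢0 a<n b≢0 b<n a+b≢n) (cong₂ _+_ (sym (*-identityʳ n)) (sym (+-identityʳ (δ b a))))
    ... | yes b≡0 | _
        rewrite 𝟙-no (admissible? b) (λ (b≢0 , _) → b≢0 b≡0)
              | ∑-completions-inadmissible (λ (b≢0 , _) → b≢0 b≡0) | *-zeroʳ n = refl
    ... | no _    | yes a+b≡n
        rewrite 𝟙-no (admissible? b) (λ (_ , a+b≢n) → a+b≢n a+b≡n)
              | ∑-completions-inadmissible (λ (_ , a+b≢n) → a+b≢n a+b≡n) | *-zeroʳ n = refl

    ∑-admissible : ∑[ b < n ] 𝟙 (admissible? b) + 2 ≡ n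
    ∑-admissible = begin
      ∑[ b < n ] 𝟙 (admissible? b) + (1 + 1)
        ≡⟨ ∑-+ n refl (∑-+ n (∑-δ-0 (≤-<-trans z≤n a<n)) (∑-δ-complement a≢0 a<n)) ⟨
      ∑[ b < n ] (𝟙 (admissible? b) + (δ b 0 + δ (a + b) n))  ≡⟨ ∑-cong n admissible+obstructions ⟩
      ∑[ b < n ] 1                                            ≡⟨ ∑-const n 1 ⟩
      n * 1                                                   ≡⟨ *-identityʳ n ⟩
      n                                                       ∎
      where
      open ≡-Reasoning
      admissible+obstructions : ∀ b → b < n → 𝟙 (admissible? b) + (δ b 0 + δ (a + b) n) ≡ 1
      admissible+obstructions b _ with b ≟ 0 | a + b ≟ n
      ... | yes refl | _
          rewrite 𝟙-no (admissible? 0) (λ (b≢0 , _) → b≢0 refl) | +-identityʳ a = cong suc (δ≡0 (<⇒≢ a<n))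
      ... | no b≢0 | yes a+b≡n
          rewrite 𝟙-no (admissible? b) (λ (_ , a+b≢n) → a+b≢n a+b≡n) | δ≡0 b≢0 = δ≡1 a+b≡n
      ... | no b≢0 | no a+b≢n
          rewrite 𝟙-yes (admissible? b) (b≢0 , a+b≢n) | δ≡0 b≢0 = cong suc (δ≡0 a+b≢n)

    admissible-self+δ : 𝟙 (admissible? a) + δ (a + a) n ≡ 1
    admissible-self+δ with a + a ≟ n
    ... | yes a+a≡n rewrite 𝟙-no (admissible? a) (λ (_ , a+a≢n) → a+a≢n a+a≡n) = δ≡1 a+a≡n
    ... | no a+a≢n  rewrite 𝟙-yes (admissible? a) (a≢0 , a+a≢n) = cong suc (δ≡0 a+a≢n)

    ∑∑-completions : ∀ {m} → n ≡ 3 + m →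
                     ∑[ b < n ] ∑[ c < n ] 𝟙 (zeroSumFreeTriple? n a b c) + δ (a + a) n ≡ m * m
    ∑∑-completions {m} n≡3+m = +-cancelʳ-≡ (4 * E) _ _ (begin
      Y + δ (a + a) n + 4 * E                    ≡⟨ xy∙z≈xz∙y Y (δ (a + a) n) (4 * E) ⟩
      Y + 4 * E + δ (a + a) n                    ≡⟨ cong (_+ δ (a + a) n) Y+4E ⟩
      n * E + 𝟙 (admissible? a) + δ (a + a) n    ≡⟨ +-assoc (n * E) _ _ ⟩
      n * E + (𝟙 (admissible? a) + δ (a + a) n)  ≡⟨ cong (n * E +_) admissible-self+δ ⟩
      n * E + 1                                  ≡⟨ cong₂ (λ x e → x * e + 1) n≡3+m E≡1+m ⟩
      (3 + m) * (1 + m) + 1                      ≡⟨ expand m ⟩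
      m * m + 4 * (1 + m)                        ≡⟨ cong (λ e → m * m + 4 * e) E≡1+m ⟨
      m * m + 4 * E                              ∎)
      where
      open ≡-Reasoning
      Y E : ℕ
      Y = ∑[ b < n ] ∑[ c < n ] 𝟙 (zeroSumFreeTriple? n a b c)
      E = ∑[ b < n ] 𝟙 (admissible? b)
      E≡1+m : E ≡ 1 + m
      E≡1+m = +-cancelʳ-≡ 2 E (1 + m) (trans ∑-admissible (trans n≡3+m (+-comm 2 (1 + m))))
      Y+4E : Y + 4 * E ≡ n * E + 𝟙 (admissible? a)
      Y+4E = begin
        Y + 4 * E
          ≡⟨ ∑-+ n refl (∑-*ˡ n 4 (𝟙 ∘ admissible?)) ⟨
        ∑[ b < n ] (∑[ c < n ] 𝟙 (zeroSumFreeTriple? n a b c) + 4 * 𝟙 (admissible? b))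
          ≡⟨ ∑-cong n ∑-completions-weighted ⟩
        ∑[ b < n ] (n * 𝟙 (admissible? b) + 𝟙 (admissible? b) * δ b a)
          ≡⟨ ∑-+ n (∑-*ˡ n n (𝟙 ∘ admissible?)) (∑-δ-sift (𝟙 ∘ admissible?) a a<n) ⟩
        n * E + 𝟙 (admissible? a) ∎
      expand : ∀ m → (3 + m) * (1 + m) + 1 ≡ m * m + 4 * (1 + m)
      expand = solve-∀

  halves : ℕ → ℕ
  halves n = ∑[ a < n ] δ (a + a) n

  α3+halves : ∀ {n m} .{{_ : NonZero n}} → n ≡ 3 + m → α3 n + halves n ≡ m * m * (2 + m)
  α3+halves {n} {m} n≡3+m = begin
    α3 n + halves n                        ≡⟨ cong (_+ halves n) (α3≡∑ n) ⟩
    ∑[ a < n ] Y a + halves n              ≡⟨ ∑-distrib-+ n Y (λ a → δ (a + a) n) ⟨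
    ∑[ a < n ] (Y a + δ (a + a) n)         ≡⟨ ∑-cong n Y+δ ⟩
    ∑[ a < n ] (m * m * 𝟙 (¬? (a ≟ 0)))    ≡⟨ ∑-*ˡ n (m * m) (λ a → 𝟙 (¬? (a ≟ 0))) ⟩
    m * m * ∑[ a < n ] 𝟙 (¬? (a ≟ 0))      ≡⟨ cong (m * m *_) ∑-nonzero ⟩
    m * m * (2 + m)                        ∎
    where
    open ≡-Reasoning
    0<n : 0 < n
    0<n = subst (0 <_) (sym n≡3+m) z<s
    Y : ℕ → ℕ
    Y a = ∑[ b < n ] ∑[ c < n ] 𝟙 (zeroSumFreeTriple? n a b c)
    Y+δ : ∀ a → a < n → Y a + δ (a + a) n ≡ m * m * 𝟙 (¬? (a ≟ 0))
    Y+δ a a<n with a ≟ 0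
    ... | no a≢0 = begin
      Y a + δ (a + a) n       ≡⟨ ∑∑-completions a≢0 a<n n≡3+m ⟩
      m * m                   ≡⟨ *-identityʳ (m * m) ⟨
      m * m * 1               ≡⟨ cong (m * m *_) (𝟙-yes (¬? (a ≟ 0)) a≢0) ⟨
      m * m * 𝟙 (¬? (a ≟ 0))  ∎
    ... | yes refl = begin
      Y 0 + δ 0 n  ≡⟨ cong₂ _+_ Y0≡0 (δ≡0 (<⇒≢ 0<n)) ⟩
      0            ≡⟨ *-zeroʳ (m * m) ⟨
      m * m * 0    ∎
      where
      Y0≡0 : Y 0 ≡ 0
      Y0≡0 = ∑-zero n (λ b _ → ∑-zero n (λ c _ →
               𝟙-no (zeroSumFreeTriple? n 0 b c) (λ ((0≢0 , _) , _) → 0≢0 refl)))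
    ∑-nonzero : ∑[ a < n ] 𝟙 (¬? (a ≟ 0)) ≡ 2 + m
    ∑-nonzero = +-cancelʳ-≡ 1 _ (2 + m) (begin
      ∑[ a < n ] 𝟙 (¬? (a ≟ 0)) + 1        ≡⟨ ∑-+ n refl (∑-δ-0 0<n) ⟨
      ∑[ a < n ] (𝟙 (¬? (a ≟ 0)) + δ a 0)  ≡⟨ ∑-cong n (λ a _ → 𝟙-¬ (a ≟ 0)) ⟩
      ∑[ a < n ] 1                         ≡⟨ ∑-const n 1 ⟩
      n * 1                                ≡⟨ trans (*-identityʳ n) n≡3+m ⟩
      3 + m                                ≡⟨ +-comm 1 (2 + m) ⟩
      2 + m + 1                            ∎)

  x+x≢1+y+y : ∀ x y → x + x ≢ suc (y + y)
  x+x≢1+y+y zero    y       ()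
  x+x≢1+y+y (suc x) zero    e rewrite +-suc x x = 1+n≢0 (suc-injective e)
  x+x≢1+y+y (suc x) (suc y) e rewrite +-suc x x | +-suc y y = x+x≢1+y+y x y (suc-injective (suc-injective e))

  halves-even : ∀ k → 0 < k → halves (k + k) ≡ 1
  halves-even k 0<k = begin
    ∑[ a < k + k ] δ (a + a) (k + k)
      ≡⟨ ∑-cong (k + k) (λ a _ → 𝟙-cong a+a≡k+k⇔a≡k (a + a ≟ k + k) (a ≟ k)) ⟩
    ∑[ a < k + k ] δ a k              ≡⟨ ∑-δ (k + k) k ⟩
    𝟙 (k <? k + k)                    ≡⟨ 𝟙-yes (k <? k + k) (m<m+n k 0<k) ⟩
    1                                 ∎
    where
    open ≡-Reasoning
    a+a≡k+k⇔a≡k : ∀ {a} → a + a ≡ k + k ⇔ a ≡ k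
    a+a≡k+k⇔a≡k {a} = mk⇔ (λ e → trans (n≡⌊n+n/2⌋ a) (trans (cong ⌊_/2⌋ e) (sym (n≡⌊n+n/2⌋ k))))
                            (λ { refl → refl })

  halves-odd : ∀ j → halves (suc (j + j)) ≡ 0
  halves-odd j = ∑-zero (suc (j + j)) (λ a _ → δ≡0 (x+x≢1+y+y a j))

  even-or-odd : ∀ n → (∃[ j ] n ≡ j + j) ⊎ (∃[ j ] n ≡ suc (j + j))
  even-or-odd zero    = inj₁ (0 , refl)
  even-or-odd (suc n) with even-or-odd n
  ... | inj₁ (j , refl) = inj₂ (j , refl)
  ... | inj₂ (j , refl) = inj₁ (suc j , cong suc (sym (+-suc j j)))

open import Data.Integer using (+_; _+_; _-_; _*_; _^_; -_)
open import Data.Integer.Properties using (pos-+; pos-*)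
open import Data.Integer.Tactic.RingSolver using (solve-∀)
open import Data.Nat using (ℕ; zero; suc; _≥_; _∸_; _<_; s≤s; z≤n; z<s; >-nonZero)
import Data.Nat as ℕ
open import Data.Nat.Properties using (<-≤-trans; +-suc)
open import Data.Product.Base using (_,_)
open import Data.Sum.Base using (inj₁; inj₂)
open import Relation.Binary.PropositionalEquality using (_≡_; refl; trans; cong; cong₂; module ≡-Reasoning)

open Counting using (α3+halves; halves; halves-even; halves-odd; even-or-odd)

[-1]^[j+j]≡1 : ∀ j → (- + 1) ^ (j ℕ.+ j) ≡ + 1
[-1]^[j+j]≡1 zero    = refl
[-1]^[j+j]≡1 (suc j) rewrite +-suc j j | [-1]^[j+j]≡1 j = refl

1+[-1]^[n∸1]≡2-2*halves : ∀ n → 0 < n → + 1 + (- + 1) ^ (n ∸ 1) ≡ + 2 - + 2 * + halves n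
1+[-1]^[n∸1]≡2-2*halves n 0<n with even-or-odd n
1+[-1]^[n∸1]≡2-2*halves _ () | inj₁ (zero , refl)
... | inj₁ (suc i , refl) rewrite halves-even (suc i) z<s | +-suc i i | [-1]^[j+j]≡1 i = refl
... | inj₂ (j , refl)     rewrite halves-odd j | [-1]^[j+j]≡1 j = refl

+α3≡m*m*[2+m]-halves : ∀ m → + α3 (3 ℕ.+ m) ≡ + m * + m * (+ 2 + + m) - + halves (3 ℕ.+ m)
+α3≡m*m*[2+m]-halves m = begin
  + α                              ≡⟨ x≡x+y-y (+ α) (+ h) ⟩
  + α + + h - + h                  ≡⟨ cong (_- + h) (pos-+ α h) ⟨
  + (α ℕ.+ h) - + h                ≡⟨ cong (λ x → + x - + h) (α3+halves {m = m} refl) ⟩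
  + (m ℕ.* m ℕ.* (2 ℕ.+ m)) - + h  ≡⟨ cong (_- + h) (trans (pos-* (m ℕ.* m) (2 ℕ.+ m))
                                                            (cong₂ _*_ (pos-* m m) (pos-+ 2 m))) ⟩
  + m * + m * (+ 2 + + m) - + h    ∎
  where
  open ≡-Reasoning
  α h : ℕ
  α = α3 (3 ℕ.+ m)
  h = halves (3 ℕ.+ m)
  x≡x+y-y : ∀ x y → x ≡ x + y - y
  x≡x+y-y = solve-∀

-- The powers are written out because the ring solver does not recognise ℤ's _^_; the right-hand
-- side is definitionally the polynomial of the theorem with n = 3 + x.
cubic-expansion : ∀ x h → + 2 * (x * x * (+ 2 + x) - h)
                            ≡ + 2 * ((+ 3 + x) * ((+ 3 + x) * ((+ 3 + x) * + 1)) - + 7 * ((+ 3 + x) * ((+ 3 + x) * + 1))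
                                     + + 15 * (+ 3 + x) - + 10) + (+ 2 - + 2 * h)
cubic-expansion = solve-∀

proposition2p7 : (n : ℕ) → (h : n ≥ 3) →
    (+ 2) * (+ α3 n {{>-nonZero (<-≤-trans (s≤s z≤n) h)}}) ≡
      (+ 2) * ((+ n) ^ 3 - (+ 7) * (+ n) ^ 2 + (+ 15) * (+ n) - (+ 10))
        + ((+ 1) + (- (+ 1)) ^ (n ∸ 1))
proposition2p7 (suc (suc (suc m))) (s≤s (s≤s (s≤s _))) = begin
  + 2 * + α3 n                                   ≡⟨ cong (+ 2 *_) (+α3≡m*m*[2+m]-halves m) ⟩
  + 2 * (+ m * + m * (+ 2 + + m) - + halves n)   ≡⟨ cubic-expansion (+ m) (+ halves n) ⟩
  + 2 * ((+ 3 + + m) ^ 3 - + 7 * (+ 3 + + m) ^ 2 + + 15 * (+ 3 + + m) - + 10) + (+ 2 - + 2 * + halves n)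
    ≡⟨ cong₂ (λ x s → + 2 * (x ^ 3 - + 7 * x ^ 2 + + 15 * x - + 10) + s)
             (pos-+ 3 m) (1+[-1]^[n∸1]≡2-2*halves n z<s) ⟨
  + 2 * ((+ n) ^ 3 - + 7 * (+ n) ^ 2 + + 15 * (+ n) - + 10) + (+ 1 + (- + 1) ^ (n ∸ 1)) ∎
  where
  open ≡-Reasoning
  n : ℕ
  n = 3 ℕ.+ m
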